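{- Let $n\ge 1$. Compute $p(n)=\sum_{k=1}^{\lfloor\sqrt n\rfloor}D(n,k)$, where each $D(n,k)$ is computed via the multisum \[ D(n,k)=\sum_{m_k=0}^{U_k} \cdots \sum_{m_2=0}^{U_2} \Bigl( 1+n-k^2 - \sum_{h=2}^k h m_h \Bigr) \prod_{i=2}^k (m_i + 1),\qquad U_j = \left\lfloor \frac{ n-k^2 - \sum_{h=j+1}^k h m_h}{j} \right\rfloor. \] Each term of the multisum for $D(n,k)$ corresponds to a tuple $(m_2,\dots,m_k)$ in the summation range. The total number of terms is $r_1(n)$, the number of partitions of $n$ into parts which mutually differ by at least $2$.
   Context: $p(n)$ is the number of partitions of $n$. $D(n,k)$ is the number of partitions of $n$ whose Durfee square has order $k$, the order being the largest $k$ with $\lambda_k\ge k$. -}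

module Defs where

open import Data.Nat using (ℕ; zero; suc; _+_; _*_; _∸_; _≤_; _<_; _≤?_; _/_)
open import Data.Nat.ListAction using (sum; product)
open import Data.List using (List; []; _∷_; map; concatMap; upTo; length; filter; foldr)
open import Data.List.Relation.Unary.All using (All)
open import Data.List.Relation.Unary.Linked using (Linked)
open import Data.Product using (_×_; _,_; proj₁; proj₂)
open import Data.Sum using (_⊎_)
open import Relation.Binary.PropositionalEquality using (_≡_)

IsPartition : ℕ → List ℕ → Set
IsPartition n λs = All (λ x → 1 ≤ x) λs × Linked (λ a b → b ≤ a) λs × sum λs ≡ n

-- 1-indexed part λ_j (0 when j is out of range, i.e. j = 0 or j > length).
part : List ℕ → ℕ → ℕ
part []       _             = 0
part (x ∷ xs) zero          = 0
part (x ∷ xs) (suc zero)    = x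
part (x ∷ xs) (suc (suc j)) = part xs (suc j)

DurfeeOrder : List ℕ → ℕ → Set
DurfeeOrder λs k = (k ≡ 0 ⊎ k ≤ part λs k) × (∀ j → k < j → part λs j < j)

IsR1Partition : ℕ → List ℕ → Set
IsR1Partition n λs = All (λ x → 1 ≤ x) λs × Linked (λ a b → b + 2 ≤ a) λs × sum λs ≡ n

-- ⌊√n⌋ = number of k ∈ {1..n} with k² ≤ n.
floorSqrt : ℕ → ℕ
floorSqrt n = length (filter (λ k → k * k ≤? n) (map suc (upTo n)))

oneTo : ℕ → List ℕ
oneTo m = map suc (upTo m)

-- The summation range of the multisum: tuples (m_j, ..., m_2), stored as
-- lists of pairs (h , m_h), with m_j ranging over 0..⌊B / j⌋ where B is the
-- remaining budget  n - k² - Σ_{h>j} h m_h .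
tuples : ℕ → ℕ → List (List (ℕ × ℕ))
tuples zero          B = [] ∷ []
tuples (suc zero)    B = [] ∷ []
tuples (suc (suc i)) B =
  concatMap (λ m → map ((suc (suc i) , m) ∷_) (tuples (suc i) (B ∸ suc (suc i) * m)))
            (upTo (suc (B / suc (suc i))))

range : ℕ → ℕ → List (List (ℕ × ℕ))
range n k = tuples k (n ∸ k * k)

weight : List (ℕ × ℕ) → ℕ
weight t = sum (map (λ p → proj₁ p * proj₂ p) t)

term : ℕ → ℕ → List (ℕ × ℕ) → ℕ
term n k t = (1 + n ∸ k * k ∸ weight t) * product (map (λ p → proj₂ p + 1) t)

multisum : ℕ → ℕ → ℕ
multisum n k = sum (map (term n k) (range n k))

totalTerms : ℕ → ℕ
totalTerms n = sum (map (λ k → length (range n k)) (oneTo (floorSqrt n)))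

module Submission where

-- Every count in the statement is the length of a duplicate-free list described by its members;
-- two such enumerations of one predicate are permutations, so have the same length.  Each claim is
-- therefore proved by exhibiting one enumeration whose length is visibly the right-hand side.
--  * A partition with Durfee square of order k is the k × k square together with a "Durfee pair":
--    the weakly decreasing list α of the k row remainders to its right and the partition β into
--    parts ≤ k below it.  Durfee pairs of size B = n − k² are generated by a recursion over the
--    width j = k, …, 2 mirroring the multisum: at width j a level m_j ≤ ⌊B_j / j⌋ is chosen and
--    split as a + b (a is added to every row of α and becomes its new last row, b parts equal to j
--    go into β).  The m_j + 1 splits give the factor (m_j + 1), and at width 1 the 1 + B_1 choices
--    of the single row give the leading factor, so durfeePairs k B has the multisum as its length.
--  * Partitions into k parts differing by at least 2, of size n, are generated by the same
--    recursion with exactly one partition per tuple (m_k, …, m_2), so they number the terms.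
--  * Grouping all partitions by Durfee order (resp. by number of parts, using k² ≤ n to stay within
--    ⌊√n⌋) enumerates the partitions of n (resp. those counted by r₁(n)).

open import Defs
open import Data.Nat
open import Data.Nat.Properties
open import Data.Nat.DivMod using (m*n/n≡m; /-monoˡ-≤; m/n*n≤m)
open import Data.Nat.ListAction using (sum; product)
open import Data.Nat.ListAction.Properties using (sum-++)
open import Data.Nat.Tactic.RingSolver using (solve-∀)
open import Data.List using (List; []; _∷_; _∷ʳ_; _++_; map; concatMap; upTo; length; filter; replicate; take; drop)
open import Data.List.Properties
  using (length-++; length-map; map-∘; length-upTo; length-take; map-++; map-injective; ∷ʳ-injective; ++-identityʳ;
         upTo-∷ʳ; filter-++; filter-accept; filter-reject; length-filter; take++drop≡id; ∷-injective)
open import Data.List.Membership.Propositional using (_∈_; find; lose)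
open import Data.List.Membership.Propositional.Properties
  using (∈-map⁺; ∈-map⁻; ∈-concatMap⁺; ∈-concatMap⁻; ∈-upTo⁺; ∈-upTo⁻)
open import Data.List.Membership.Propositional.Properties.WithK using (unique∧set⇒bag)
open import Data.List.Relation.Binary.BagAndSetEquality using (∼bag⇒↭)
open import Data.List.Relation.Binary.Permutation.Propositional.Properties using (↭-length)
open import Data.List.Relation.Unary.Any using (here; there)
open import Data.List.Relation.Unary.All as All using (All; []; _∷_)
import Data.List.Relation.Unary.All.Properties as All
open import Data.List.Relation.Unary.AllPairs using ([]; _∷_)
open import Data.List.Relation.Unary.Unique.Propositional using (Unique)
import Data.List.Relation.Unary.Unique.Propositional.Properties as Unique
open import Data.List.Relation.Unary.Linked as Linked using (Linked; []; [-]; _∷_)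
import Data.List.Relation.Unary.Linked.Properties as Linked
open import Data.Product using (_×_; _,_; proj₁; proj₂; ∃; ∃₂)
open import Data.Sum using (_⊎_; inj₁; inj₂)
open import Data.Empty using (⊥; ⊥-elim)
open import Function using (_∘_)
open import Function.Bundles using (_⇔_; mk⇔; Equivalence)
open import Relation.Binary.PropositionalEquality
open import Relation.Nullary using (¬_; yes; no)
open import Relation.Binary.Definitions using (tri<; tri≈; tri>)

private
  variable
    X Y : Set

Enumerates : List X → (X → Set) → Set
Enumerates xs P = Unique xs × (∀ z → z ∈ xs ⇔ P z)

enumeration-length : ∀ {P : X → Set} {xs ys} → Enumerates xs P → Enumerates ys P → length xs ≡ length ys
enumeration-length {xs = xs} {ys} (uxs , exs) (uys , eys) =
  ↭-length (∼bag⇒↭ (unique∧set⇒bag uxs uys (λ {z} → same z)))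
  where
  open Equivalence
  same : ∀ z → z ∈ xs ⇔ z ∈ ys
  same z = mk⇔ (from (eys z) ∘ to (exs z)) (from (exs z) ∘ to (eys z))

unique-map : (f : X → Y) {xs : List X} → Unique xs →
  (∀ {x y} → x ∈ xs → y ∈ xs → f x ≡ f y → x ≡ y) → Unique (map f xs)
unique-map f {[]} [] inj = []
unique-map f {x ∷ xs} (x∉xs ∷ u) inj =
  fresh xs x∉xs (inj (here refl) ∘ there) ∷ unique-map f u (λ p q → inj (there p) (there q))
  where
  fresh : ∀ ys → All (x ≢_) ys → (∀ {y} → y ∈ ys → f x ≡ f y → x ≡ y) → All (f x ≢_) (map f ys)
  fresh [] [] _ = []
  fresh (y ∷ ys) (x≢y ∷ ps) inj′ = (x≢y ∘ inj′ (here refl)) ∷ fresh ys ps (inj′ ∘ there)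

∈-concatMap-elim : (f : X → List Y) {xs : List X} {y : Y} → y ∈ concatMap f xs → ∃ λ x → x ∈ xs × y ∈ f x
∈-concatMap-elim f = find ∘ ∈-concatMap⁻ f

∈-concatMap-intro : (f : X → List Y) {xs : List X} {x : X} {y : Y} → x ∈ xs → y ∈ f x → y ∈ concatMap f xs
∈-concatMap-intro f x∈xs y∈fx = ∈-concatMap⁺ f (lose x∈xs y∈fx)

unique-concatMap : (f : X → List Y) {xs : List X} → Unique xs → (∀ {x} → x ∈ xs → Unique (f x)) →
  (∀ {x y z} → x ∈ xs → y ∈ xs → z ∈ f x → z ∈ f y → x ≡ y) → Unique (concatMap f xs)
unique-concatMap f {[]} [] uf disj = []
unique-concatMap f {x ∷ xs} (x∉xs ∷ u) uf disj =
  Unique.++⁺ (uf (here refl)) (unique-concatMap f u (uf ∘ there) (λ p q → disj (there p) (there q))) apart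
  where
  apart : ∀ {z} → z ∈ f x × z ∈ concatMap f xs → ⊥
  apart (z∈fx , z∈rest) with ∈-concatMap-elim f z∈rest
  ... | y , y∈xs , z∈fy = All.lookup x∉xs y∈xs (disj (here refl) (there y∈xs) z∈fx z∈fy)

enumerates-union : (f : X → List Y) {xs : List X} {P : Y → Set} (Class : Y → X → Set) → Unique xs →
  (∀ {x} → x ∈ xs → Enumerates (f x) (λ z → P z × Class z x)) →
  (∀ {z x x′} → P z → Class z x → Class z x′ → x ≡ x′) →
  (∀ {z} → P z → ∃ λ x → x ∈ xs × Class z x) →
  Enumerates (concatMap f xs) P
enumerates-union f {xs} {P} Class uxs blocks functional classified =
  unique-concatMap f uxs (proj₁ ∘ blocks) disjoint , λ z → mk⇔ sound complete
  where
  open Equivalence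
  in-block : ∀ {x z} → x ∈ xs → z ∈ f x → P z × Class z x
  in-block x∈ z∈ = to (proj₂ (blocks x∈) _) z∈
  disjoint : ∀ {x x′ z} → x ∈ xs → x′ ∈ xs → z ∈ f x → z ∈ f x′ → x ≡ x′
  disjoint x∈ x′∈ z∈ z∈′ =
    functional (proj₁ (in-block x∈ z∈)) (proj₂ (in-block x∈ z∈)) (proj₂ (in-block x′∈ z∈′))
  sound : ∀ {z} → z ∈ concatMap f xs → P z
  sound z∈ with ∈-concatMap-elim f z∈
  ... | x , x∈ , z∈fx = proj₁ (in-block x∈ z∈fx)
  complete : ∀ {z} → P z → z ∈ concatMap f xs
  complete Pz with classified Pz
  ... | x , x∈ , cls = ∈-concatMap-intro f x∈ (from (proj₂ (blocks x∈) _) (Pz , cls))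

sum-map-cong : (f g : X → ℕ) (xs : List X) → (∀ {x} → x ∈ xs → f x ≡ g x) → sum (map f xs) ≡ sum (map g xs)
sum-map-cong f g [] eq = refl
sum-map-cong f g (x ∷ xs) eq = cong₂ _+_ (eq (here refl)) (sum-map-cong f g xs (eq ∘ there))

sum-map-concatMap : (g : Y → ℕ) (f : X → List Y) (xs : List X) →
  sum (map g (concatMap f xs)) ≡ sum (map (λ x → sum (map g (f x))) xs)
sum-map-concatMap g f [] = refl
sum-map-concatMap g f (x ∷ xs) = begin
  sum (map g (f x ++ concatMap f xs))              ≡⟨ cong sum (map-++ g (f x) _) ⟩
  sum (map g (f x) ++ map g (concatMap f xs))      ≡⟨ sum-++ (map g (f x)) _ ⟩
  sum (map g (f x)) + sum (map g (concatMap f xs)) ≡⟨ cong (sum (map g (f x)) +_) (sum-map-concatMap g f xs) ⟩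
  sum (map g (f x)) + sum (map (λ y → sum (map g (f y))) xs) ∎
  where open ≡-Reasoning

length-concatMap : (f : X → List Y) (xs : List X) → length (concatMap f xs) ≡ sum (map (length ∘ f) xs)
length-concatMap f [] = refl
length-concatMap f (x ∷ xs) = trans (length-++ (f x)) (cong (length (f x) +_) (length-concatMap f xs))

sum-map-const-* : (c : ℕ) (f : X → ℕ) (xs : List X) → sum (map (λ x → c * f x) xs) ≡ c * sum (map f xs)
sum-map-const-* c f [] = sym (*-zeroʳ c)
sum-map-const-* c f (x ∷ xs) = trans (cong (c * f x +_) (sum-map-const-* c f xs)) (sym (*-distribˡ-+ c (f x) _))

sum-map-const : (c : ℕ) (xs : List X) → sum (map (λ _ → c) xs) ≡ length xs * c
sum-map-const c [] = refl
sum-map-const c (x ∷ xs) = cong (c +_) (sum-map-const c xs)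

sum-map-+ : (c : ℕ) (xs : List ℕ) → sum (map (_+ c) xs) ≡ sum xs + length xs * c
sum-map-+ c [] = refl
sum-map-+ c (x ∷ xs) = trans (cong (x + c +_) (sum-map-+ c xs)) (shuffle x c (sum xs) (length xs))
  where
  shuffle : ∀ x c s l → x + c + (s + l * c) ≡ x + s + (c + l * c)
  shuffle = solve-∀

sum-replicate : (b x : ℕ) → sum (replicate b x) ≡ b * x
sum-replicate zero x = refl
sum-replicate (suc b) x = cong (x +_) (sum-replicate b x)

Decreasing : List ℕ → Set
Decreasing = Linked (λ a b → b ≤ a)

Gapped : List ℕ → Set
Gapped = Linked (λ a b → b + 2 ≤ a)

linked-++ : {R : X → X → Set} (xs : List X) {ys : List X} → Linked R xs → Linked R ys →
  All (λ x → All (R x) ys) xs → Linked R (xs ++ ys)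
linked-++ [] _ lys _ = lys
linked-++ (x ∷ []) {[]} _ _ _ = [-]
linked-++ (x ∷ []) {y ∷ ys} _ lys ((r ∷ _) ∷ []) = r ∷ lys
linked-++ (x ∷ x′ ∷ xs) (r ∷ lxs) lys (_ ∷ rs) = r ∷ linked-++ (x′ ∷ xs) lxs lys rs

linked-++⁻ : {R : X → X → Set} (xs : List X) {ys : List X} → Linked R (xs ++ ys) → Linked R xs × Linked R ys
linked-++⁻ [] l = [] , l
linked-++⁻ (x ∷ []) {[]} l = [-] , []
linked-++⁻ (x ∷ []) {y ∷ ys} (_ ∷ l) = [-] , l
linked-++⁻ (x ∷ x′ ∷ xs) (r ∷ l) with linked-++⁻ (x′ ∷ xs) l
... | lxs , lys = r ∷ lxs , lys

linked-map : {R S : X → X → Set} {P : X → Set} (f : X → X) {xs : List X} → Linked R xs → All P xs →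
  (∀ {a b} → P a → P b → R a b → S (f a) (f b)) → Linked S (map f xs)
linked-map f [] _ _ = []
linked-map f [-] _ _ = [-]
linked-map f (r ∷ l) (pa ∷ pb ∷ ps) h = h pa pb r ∷ linked-map f l (pb ∷ ps) h

linked-last : {R : X → X → Set} → (∀ {a b c} → R a b → R b c → R a c) →
  (xs : List X) {y : X} → Linked R (xs ∷ʳ y) → All (λ a → R a y) xs
linked-last trans′ [] _ = []
linked-last trans′ (x ∷ []) (r ∷ _) = r ∷ []
linked-last trans′ (x ∷ x′ ∷ xs) (r ∷ l) with linked-last trans′ (x′ ∷ xs) l
... | r′ ∷ rs = trans′ r r′ ∷ r′ ∷ rs

decreasing-head : ∀ x xs → Decreasing (x ∷ xs) → All (_≤ x) xs
decreasing-head x [] _ = []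
decreasing-head x (y ∷ ys) (y≤x ∷ l) = y≤x ∷ All.map (λ z≤y → ≤-trans z≤y y≤x) (decreasing-head y ys l)

decreasing-replicate : (b x : ℕ) → Decreasing (replicate b x)
decreasing-replicate zero x = []
decreasing-replicate (suc zero) x = [-]
decreasing-replicate (suc (suc b)) x = ≤-refl ∷ decreasing-replicate (suc b) x

replicate-++-injective : ∀ {x} b b′ {ys ys′ : List ℕ} → All (_< x) ys → All (_< x) ys′ →
  replicate b x ++ ys ≡ replicate b′ x ++ ys′ → b ≡ b′ × ys ≡ ys′
replicate-++-injective zero zero _ _ eq = refl , eq
replicate-++-injective zero (suc b′) (x<x ∷ _) _ refl = ⊥-elim (<-irrefl refl x<x)
replicate-++-injective (suc b) zero _ (x<x ∷ _) refl = ⊥-elim (<-irrefl refl x<x)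
replicate-++-injective (suc b) (suc b′) p q eq with replicate-++-injective b b′ p q (proj₂ (∷-injective eq))
... | refl , eq′ = refl , eq′

shift-decreasing : ∀ a {α} → Decreasing α → Decreasing (map (_+ a) α)
shift-decreasing a = Linked.map⁺ ∘ Linked.map (+-monoˡ-≤ a)

map-+-∸ : ∀ c xs → All (c ≤_) xs → map (_+ c) (map (_∸ c) xs) ≡ xs
map-+-∸ c [] [] = refl
map-+-∸ c (x ∷ xs) (c≤x ∷ ps) = cong₂ _∷_ (m∸n+n≡m c≤x) (map-+-∸ c xs ps)

split-last : (xs : List X) (j : ℕ) → length xs ≡ suc j → ∃₂ λ ys y → xs ≡ ys ∷ʳ y × length ys ≡ j
split-last (x ∷ []) zero refl = [] , x , refl , refl
split-last (x ∷ x′ ∷ xs) (suc j) eq with split-last (x′ ∷ xs) j (suc-injective eq)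
... | ys , y , eq′ , len = x ∷ ys , y , cong (x ∷_) eq′ , cong suc len

++-split : (xs xs′ ys ys′ : List X) → length xs ≡ length xs′ → xs ++ ys ≡ xs′ ++ ys′ → xs ≡ xs′ × ys ≡ ys′
++-split [] [] ys ys′ _ eq = refl , eq
++-split (x ∷ xs) (x′ ∷ xs′) ys ys′ len eq with ∷-injective eq
... | refl , eq′ with ++-split xs xs′ ys ys′ (suc-injective len) eq′
... | refl , refl = refl , refl

squaresUpTo : ℕ → ℕ → ℕ
squaresUpTo N M = length (filter (λ k → k * k ≤? M) (oneTo N))

oneTo-suc : ∀ N → oneTo (suc N) ≡ oneTo N ∷ʳ suc N
oneTo-suc N = trans (cong (map suc) (sym (upTo-∷ʳ N))) (map-++ suc (upTo N) (N ∷ []))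

squaresUpTo-≤ : ∀ N M → squaresUpTo N M ≤ N
squaresUpTo-≤ N M = ≤-trans (length-filter (λ k → k * k ≤? M) (oneTo N))
  (≤-reflexive (trans (length-map suc (upTo N)) (length-upTo N)))

squaresUpTo-suc : ∀ N M → squaresUpTo (suc N) M ≡ squaresUpTo N M + length (filter (λ k → k * k ≤? M) (suc N ∷ []))
squaresUpTo-suc N M = trans (cong (length ∘ filter P?) (oneTo-suc N))
  (trans (cong length (filter-++ P? (oneTo N) _)) (length-++ (filter P? (oneTo N))))
  where P? = λ k → k * k ≤? M

data SquareStep (N M : ℕ) : Set where
  square    : suc N * suc N ≤ M → squaresUpTo (suc N) M ≡ suc (squaresUpTo N M) → SquareStep N M
  nonsquare : ¬ (suc N * suc N ≤ M) → squaresUpTo (suc N) M ≡ squaresUpTo N M → SquareStep N M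

squareStep : ∀ N M → SquareStep N M
squareStep N M with suc N * suc N ≤? M
... | yes sq = square sq (trans (squaresUpTo-suc N M)
        (trans (cong (λ l → squaresUpTo N M + length l) (filter-accept (λ k → k * k ≤? M) sq)) (+-comm _ 1)))
... | no ¬sq = nonsquare ¬sq (trans (squaresUpTo-suc N M)
        (trans (cong (λ l → squaresUpTo N M + length l) (filter-reject (λ k → k * k ≤? M) ¬sq)) (+-identityʳ _)))

square-mono : ∀ {a b} → a ≤ b → a * a ≤ b * b
square-mono a≤b = *-mono-≤ a≤b a≤b

squaresUpTo-mono : ∀ N M → squaresUpTo N M ≤ squaresUpTo (suc N) M
squaresUpTo-mono N M with squareStep N M
... | square _ eq    = ≤-trans (n≤1+n _) (≤-reflexive (sym eq))
... | nonsquare _ eq = ≤-reflexive (sym eq)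

squaresUpTo-sound : ∀ N M k → k ≤ squaresUpTo N M → k * k ≤ M
squaresUpTo-sound zero M zero _ = z≤n
squaresUpTo-sound (suc N) M k k≤ with squareStep N M
... | nonsquare _ eq = squaresUpTo-sound N M k (subst (k ≤_) eq k≤)
... | square sq eq with m≤n⇒m<n∨m≡n (subst (k ≤_) eq k≤)
...   | inj₁ (s≤s k≤′) = squaresUpTo-sound N M k k≤′
...   | inj₂ refl      = ≤-trans (square-mono (s≤s (squaresUpTo-≤ N M))) sq

squaresUpTo-complete : ∀ N M k → k ≤ N → k * k ≤ M → k ≤ squaresUpTo N M
squaresUpTo-complete N M zero _ _ = z≤n
squaresUpTo-complete (suc N) M (suc k) (s≤s k≤N) sq with m≤n⇒m<n∨m≡n k≤N
... | inj₁ k<N = ≤-trans (squaresUpTo-complete N M (suc k) k<N sq) (squaresUpTo-mono N M)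
... | inj₂ refl with squareStep k M
...   | nonsquare ¬sq _ = ⊥-elim (¬sq sq)
...   | square _ eq = subst (suc k ≤_) (sym eq)
          (s≤s (squaresUpTo-complete k M k ≤-refl (≤-trans (square-mono (n≤1+n k)) sq)))

floorSqrt-sound : ∀ n k → k ≤ floorSqrt n → k * k ≤ n
floorSqrt-sound n = squaresUpTo-sound n n

floorSqrt-complete : ∀ n k → k * k ≤ n → k ≤ floorSqrt n
floorSqrt-complete n zero _ = z≤n
floorSqrt-complete n (suc k) sq = squaresUpTo-complete n n (suc k) (≤-trans (m≤m*n (suc k) (suc k)) sq) sq

∈-upTo-quotient⁺ : ∀ j m B .{{_ : NonZero j}} → j * m ≤ B → m ∈ upTo (suc (B / j))
∈-upTo-quotient⁺ j m B jm≤B =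
  ∈-upTo⁺ (s≤s (subst (_≤ B / j) (m*n/n≡m m j) (/-monoˡ-≤ j (subst (_≤ B) (*-comm j m) jm≤B))))

∈-upTo-quotient⁻ : ∀ j m B .{{_ : NonZero j}} → m ∈ upTo (suc (B / j)) → j * m ≤ B
∈-upTo-quotient⁻ j m B m∈ with ∈-upTo⁻ m∈
... | s≤s m≤B/j = ≤-trans (≤-reflexive (*-comm j m)) (≤-trans (*-monoˡ-≤ j m≤B/j) (m/n*n≤m B j))

-- A Durfee pair of width j and size B: α is a weakly decreasing list of length j (the parts of a
-- partition to the right of its j × j Durfee square, zeros allowed) and β a partition into parts
-- of size at most j (the part below the square); together they have size B.
DurfeePair : ℕ → ℕ → List ℕ × List ℕ → Set
DurfeePair j B (α , β) =
  length α ≡ j × Decreasing α × All (λ x → 1 ≤ x × x ≤ j) β × Decreasing β × sum α + sum β ≡ B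

-- Passing from width j - 1 to width j: raise α by a and append a as its new last entry, and put
-- b parts equal to j in front of β.  Together this adds j·(a + b) to the size.
extendPair : ℕ → ℕ → ℕ → List ℕ × List ℕ → List ℕ × List ℕ
extendPair j a b (α , β) = map (_+ a) α ∷ʳ a , replicate b j ++ β

mutual
  durfeePairs : ℕ → ℕ → List (List ℕ × List ℕ)
  durfeePairs zero B = []
  durfeePairs (suc zero) B = map (λ a → a ∷ [] , replicate (B ∸ a) 1) (upTo (suc B))
  durfeePairs (suc (suc i)) B = concatMap (levelBlock (suc i) B) (upTo (suc (B / suc (suc i))))

  levelBlock : ℕ → ℕ → ℕ → List (List ℕ × List ℕ)
  levelBlock i B m = concatMap (λ a → map (extendPair (suc i) a (m ∸ a)) (durfeePairs i (B ∸ suc i * m)))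
                               (upTo (suc m))

extendPair-sum : ∀ i a b α β → length α ≡ suc i →
  sum (map (_+ a) α ∷ʳ a) + sum (replicate b (suc (suc i)) ++ β) ≡ (sum α + sum β) + suc (suc i) * (a + b)
extendPair-sum i a b α β len = begin
  sum (map (_+ a) α ∷ʳ a) + sum (replicate b j ++ β)
    ≡⟨ cong₂ _+_ (sum-++ (map (_+ a) α) _) (sum-++ (replicate b j) β) ⟩
  sum (map (_+ a) α) + (a + 0) + (sum (replicate b j) + sum β)
    ≡⟨ cong₂ (λ u v → u + (a + 0) + (v + sum β)) (sum-map-+ a α) (sum-replicate b j) ⟩
  sum α + length α * a + (a + 0) + (b * j + sum β)
    ≡⟨ cong (λ l → sum α + l * a + (a + 0) + (b * j + sum β)) len ⟩
  sum α + suc i * a + (a + 0) + (b * j + sum β)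
    ≡⟨ regroup (sum α) (sum β) i a b ⟩
  (sum α + sum β) + j * (a + b) ∎
  where
  open ≡-Reasoning
  j = suc (suc i)
  regroup : ∀ x y i a b → x + suc i * a + (a + 0) + (b * suc (suc i) + y) ≡ (x + y) + suc (suc i) * (a + b)
  regroup = solve-∀

extendPair-sound : ∀ i B m a p → suc (suc i) * m ≤ B → a ≤ m →
  DurfeePair (suc i) (B ∸ suc (suc i) * m) p → DurfeePair (suc (suc i)) B (extendPair (suc (suc i)) a (m ∸ a) p)
extendPair-sound i B m a (α , β) jm≤B a≤m (len , decα , boundsβ , decβ , size) =
  len′ , decα′ , boundsβ′ , decβ′ , size′
  where
  j = suc (suc i)
  len′ : length (map (_+ a) α ∷ʳ a) ≡ j
  len′ = trans (length-++ (map (_+ a) α)) (trans (cong (_+ 1) (trans (length-map (_+ a) α) len)) (+-comm (suc i) 1))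
  decα′ : Decreasing (map (_+ a) α ∷ʳ a)
  decα′ = linked-++ (map (_+ a) α) (shift-decreasing a decα) [-] (All.map⁺ (All.tabulate (λ {x} _ → m≤n+m a x ∷ [])))
  boundsβ′ : All (λ x → 1 ≤ x × x ≤ j) (replicate (m ∸ a) j ++ β)
  boundsβ′ = All.++⁺ (All.replicate⁺ (m ∸ a) (s≤s z≤n , ≤-refl)) (All.map (λ (p , q) → p , m≤n⇒m≤1+n q) boundsβ)
  decβ′ : Decreasing (replicate (m ∸ a) j ++ β)
  decβ′ = linked-++ (replicate (m ∸ a) j) (decreasing-replicate (m ∸ a) j) decβ
            (All.replicate⁺ (m ∸ a) (All.map (λ (_ , q) → m≤n⇒m≤1+n q) boundsβ))
  size′ : sum (map (_+ a) α ∷ʳ a) + sum (replicate (m ∸ a) j ++ β) ≡ B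
  size′ = begin
    sum (map (_+ a) α ∷ʳ a) + sum (replicate (m ∸ a) j ++ β) ≡⟨ extendPair-sum i a (m ∸ a) α β len ⟩
    (sum α + sum β) + j * (a + (m ∸ a))                    ≡⟨ cong₂ (λ u v → u + j * v) size (m+[n∸m]≡n a≤m) ⟩
    (B ∸ j * m) + j * m                                    ≡⟨ m∸n+n≡m jm≤B ⟩
    B ∎
    where open ≡-Reasoning

termAt : ℕ → List (ℕ × ℕ) → ℕ
termAt c t = (c ∸ weight t) * product (map (λ p → proj₂ p + 1) t)

termAt-cons : ∀ j m B t → j * m ≤ B → termAt (suc B) ((j , m) ∷ t) ≡ suc m * termAt (suc (B ∸ j * m)) t
termAt-cons j m B t jm≤B = begin
  (suc B ∸ (j * m + weight t)) * ((m + 1) * P)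
    ≡⟨ cong (_* ((m + 1) * P)) (sym (∸-+-assoc (suc B) (j * m) (weight t))) ⟩
  (suc B ∸ j * m ∸ weight t) * ((m + 1) * P)
    ≡⟨ cong (λ c → (c ∸ weight t) * ((m + 1) * P)) (+-∸-assoc 1 jm≤B) ⟩
  (suc (B ∸ j * m) ∸ weight t) * ((m + 1) * P)
    ≡⟨ reorder (suc (B ∸ j * m) ∸ weight t) m P ⟩
  suc m * ((suc (B ∸ j * m) ∸ weight t) * P) ∎
  where
  open ≡-Reasoning
  P = product (map (λ p → proj₂ p + 1) t)
  reorder : ∀ X m P → X * ((m + 1) * P) ≡ suc m * (X * P)
  reorder = solve-∀

levelBlock-length : ∀ i B m → suc i * m ≤ B →
  length (durfeePairs i (B ∸ suc i * m)) ≡ sum (map (termAt (suc (B ∸ suc i * m))) (tuples i (B ∸ suc i * m))) →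
  length (levelBlock i B m) ≡ sum (map (termAt (suc B)) (map ((suc i , m) ∷_) (tuples i (B ∸ suc i * m))))
levelBlock-length i B m jm≤B narrower = begin
  length (levelBlock i B m)
    ≡⟨ length-concatMap (λ a → map (extendPair (suc i) a (m ∸ a)) Ps) (upTo (suc m)) ⟩
  sum (map (λ a → length (map (extendPair (suc i) a (m ∸ a)) Ps)) (upTo (suc m)))
    ≡⟨ sum-map-cong _ (λ _ → length Ps) (upTo (suc m)) (λ {a} _ → length-map (extendPair (suc i) a (m ∸ a)) Ps) ⟩
  sum (map (λ _ → length Ps) (upTo (suc m)))
    ≡⟨ trans (sum-map-const (length Ps) (upTo (suc m))) (cong (_* length Ps) (length-upTo (suc m))) ⟩
  suc m * length Ps
    ≡⟨ cong (suc m *_) narrower ⟩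
  suc m * sum (map (termAt (suc B′)) ts)
    ≡⟨ sym (sum-map-const-* (suc m) (termAt (suc B′)) ts) ⟩
  sum (map (λ t → suc m * termAt (suc B′) t) ts)
    ≡⟨ sum-map-cong _ _ ts (λ {t} _ → sym (termAt-cons (suc i) m B t jm≤B)) ⟩
  sum (map (λ t → termAt (suc B) ((suc i , m) ∷ t)) ts)
    ≡⟨ cong sum (map-∘ ts) ⟩
  sum (map (termAt (suc B)) (map ((suc i , m) ∷_) ts)) ∎
  where
  open ≡-Reasoning
  B′ = B ∸ suc i * m
  Ps = durfeePairs i B′
  ts = tuples i B′

durfeePairs-length : ∀ i B → length (durfeePairs (suc i) B) ≡ sum (map (termAt (suc B)) (tuples (suc i) B))
durfeePairs-length zero B =
  trans (length-map _ (upTo (suc B))) (trans (length-upTo (suc B)) (sym (trans (+-identityʳ _) (*-identityʳ (suc B)))))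
durfeePairs-length (suc i) B = begin
  length (concatMap (levelBlock (suc i) B) ms)
    ≡⟨ length-concatMap (levelBlock (suc i) B) ms ⟩
  sum (map (length ∘ levelBlock (suc i) B) ms)
    ≡⟨ sum-map-cong _ _ ms (λ {m} m∈ms → levelBlock-length (suc i) B m (∈-upTo-quotient⁻ j m B m∈ms)
                                              (durfeePairs-length i (B ∸ j * m))) ⟩
  sum (map (λ m → sum (map (termAt (suc B)) (map ((j , m) ∷_) (tuples (suc i) (B ∸ j * m))))) ms)
    ≡⟨ sym (sum-map-concatMap (termAt (suc B)) (λ m → map ((j , m) ∷_) (tuples (suc i) (B ∸ j * m))) ms) ⟩
  sum (map (termAt (suc B)) (tuples j B)) ∎
  where
  open ≡-Reasoning
  j = suc (suc i)
  ms = upTo (suc (B / j))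

∈-levelBlock⁻ : ∀ i B m {z} → z ∈ levelBlock i B m →
  ∃₂ λ a p → a ≤ m × p ∈ durfeePairs i (B ∸ suc i * m) × z ≡ extendPair (suc i) a (m ∸ a) p
∈-levelBlock⁻ i B m z∈ with ∈-concatMap-elim _ z∈
... | a , a∈ , z∈′ with ∈-map⁻ (extendPair (suc i) a (m ∸ a)) z∈′
... | p , p∈ , eq = a , p , ≤-pred (∈-upTo⁻ a∈) , p∈ , eq

∈-levelBlock⁺ : ∀ i B m a {p} → a ≤ m → p ∈ durfeePairs i (B ∸ suc i * m) →
  extendPair (suc i) a (m ∸ a) p ∈ levelBlock i B m
∈-levelBlock⁺ i B m a a≤m p∈ = ∈-concatMap-intro _ (∈-upTo⁺ (s≤s a≤m)) (∈-map⁺ _ p∈)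

durfeePairs-sound : ∀ i B {p} → p ∈ durfeePairs (suc i) B → DurfeePair (suc i) B p
durfeePairs-sound zero B p∈ with ∈-map⁻ (λ a → a ∷ [] , replicate (B ∸ a) 1) p∈
... | a , a∈ , refl = refl , [-] , All.replicate⁺ (B ∸ a) (≤-refl , ≤-refl) , decreasing-replicate (B ∸ a) 1 ,
      trans (cong₂ _+_ (+-identityʳ a) (trans (sum-replicate (B ∸ a) 1) (*-identityʳ _)))
            (m+[n∸m]≡n (≤-pred (∈-upTo⁻ a∈)))
durfeePairs-sound (suc i) B p∈ with ∈-concatMap-elim (levelBlock (suc i) B) p∈
... | m , m∈ , p∈′ with ∈-levelBlock⁻ (suc i) B m p∈′
... | a , q , a≤m , q∈ , refl =
  extendPair-sound i B m a q (∈-upTo-quotient⁻ (suc (suc i)) m B m∈) a≤m (durfeePairs-sound i _ q∈)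

durfeePair-β-bound : ∀ i B {α β} → DurfeePair i B (α , β) → All (_≤ i) β
durfeePair-β-bound i B (_ , _ , bounds , _) = All.map proj₂ bounds

split-top : ∀ i β → All (λ x → 1 ≤ x × x ≤ suc i) β → Decreasing β →
  ∃₂ λ b β′ → β ≡ replicate b (suc i) ++ β′ × All (λ x → 1 ≤ x × x ≤ i) β′ × Decreasing β′
split-top i [] _ _ = 0 , [] , refl , [] , []
split-top i (x ∷ β) ((1≤x , x≤1+i) ∷ bounds) dec with x ≟ suc i
... | yes refl with split-top i β bounds (Linked.tail dec)
...   | b , β′ , refl , bounds′ , dec′ = suc b , β′ , refl , bounds′ , dec′
split-top i (x ∷ β) ((1≤x , x≤1+i) ∷ bounds) dec | no x≢1+i = 0 , x ∷ β , refl , below , dec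
  where
  x≤i : x ≤ i
  x≤i = ≤-pred (≤∧≢⇒< x≤1+i x≢1+i)
  below : All (λ y → 1 ≤ y × y ≤ i) (x ∷ β)
  below = (1≤x , x≤i) ∷ All.zipWith (λ ((1≤y , _) , y≤x) → 1≤y , ≤-trans y≤x x≤i) (bounds , decreasing-head x β dec)

durfeePair-split : ∀ i B α β → DurfeePair (suc (suc i)) B (α , β) →
  ∃₂ λ a b → ∃₂ λ α′ β′ → DurfeePair (suc i) (sum α′ + sum β′) (α′ , β′) ×
    (sum α′ + sum β′) + suc (suc i) * (a + b) ≡ B × extendPair (suc (suc i)) a b (α′ , β′) ≡ (α , β)
durfeePair-split i B α β (len , decα , boundsβ , decβ , size)
  with split-last α (suc i) len | split-top (suc i) β boundsβ decβ
... | α₀ , a , refl , len₀ | b , β′ , refl , bounds′ , dec′ =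
  a , b , α′ , β′ , (len′ , decα′ , bounds′ , dec′ , refl) , size′ ,
  cong (λ l → l ∷ʳ a , replicate b j ++ β′) α₀-eq
  where
  j = suc (suc i)
  above : All (a ≤_) α₀
  above = linked-last (λ p q → ≤-trans q p) α₀ decα
  α′ = map (_∸ a) α₀
  α₀-eq : map (_+ a) α′ ≡ α₀
  α₀-eq = map-+-∸ a α₀ above
  len′ : length α′ ≡ suc i
  len′ = trans (length-map (_∸ a) α₀) len₀
  decα′ : Decreasing α′
  decα′ = linked-map (_∸ a) (proj₁ (linked-++⁻ α₀ decα)) above (λ _ _ r → ∸-monoˡ-≤ a r)
  size′ : sum α′ + sum β′ + j * (a + b) ≡ B
  size′ = trans (sym (extendPair-sum i a b α′ β′ len′))
                (trans (cong (λ l → sum (l ∷ʳ a) + sum (replicate b j ++ β′)) α₀-eq) size)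

durfeePairs-complete : ∀ i B {p} → DurfeePair (suc i) B p → p ∈ durfeePairs (suc i) B
durfeePairs-complete zero B {α , β} (len , _ , boundsβ , decβ , size)
  with split-last α 0 len | split-top 0 β boundsβ decβ
... | _ , _ , _ , _ | _ , y ∷ _ , _ , (1≤y , y≤0) ∷ _ , _ = ⊥-elim (1+n≰n (≤-trans 1≤y y≤0))
... | [] , x , refl , _ | b , [] , refl , _ , _ =
  subst (λ c → (x ∷ [] , c) ∈ durfeePairs 1 B) ones (∈-map⁺ _ (∈-upTo⁺ (s≤s (subst (x ≤_) x+b≡B (m≤m+n x b)))))
  where
  x+b≡B : x + b ≡ B
  x+b≡B = trans (cong₂ _+_ (sym (+-identityʳ x))
                  (sym (trans (sum-++ (replicate b 1) []) (trans (+-identityʳ _) (trans (sum-replicate b 1) (*-identityʳ b))))))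
                size
  ones : replicate (B ∸ x) 1 ≡ replicate b 1 ++ []
  ones = trans (cong (λ c → replicate c 1) (trans (cong (_∸ x) (sym x+b≡B)) (m+n∸m≡n x b))) (sym (++-identityʳ _))
durfeePairs-complete (suc i) B {α , β} spec with durfeePair-split i B α β spec
... | a , b , α′ , β′ , narrower , size , refl =
  ∈-concatMap-intro (levelBlock (suc i) B) (∈-upTo-quotient⁺ j (a + b) B jm≤B)
    (subst (_∈ levelBlock (suc i) B (a + b)) (cong (λ c → extendPair j a c (α′ , β′)) (m+n∸m≡n a b))
      (∈-levelBlock⁺ (suc i) B (a + b) a (m≤m+n a b) narrower∈))
  where
  j = suc (suc i)
  jm≤B : j * (a + b) ≤ B
  jm≤B = subst (j * (a + b) ≤_) size (m≤n+m (j * (a + b)) (sum α′ + sum β′))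
  narrower∈ : (α′ , β′) ∈ durfeePairs (suc i) (B ∸ j * (a + b))
  narrower∈ = subst (λ c → (α′ , β′) ∈ durfeePairs (suc i) c)
    (sym (trans (cong (_∸ j * (a + b)) (sym size)) (m+n∸n≡m (sum α′ + sum β′) (j * (a + b)))))
    (durfeePairs-complete i _ narrower)

extendPair-injective : ∀ i {a a′ b b′ α α′ β β′} → All (_≤ suc i) β → All (_≤ suc i) β′ →
  extendPair (suc (suc i)) a b (α , β) ≡ extendPair (suc (suc i)) a′ b′ (α′ , β′) →
  a ≡ a′ × b ≡ b′ × (α , β) ≡ (α′ , β′)
extendPair-injective i {a} {a′} {b} {b′} {α} {α′} boundβ boundβ′ eq
  with ∷ʳ-injective (map (_+ a) α) (map (_+ a′) α′) (cong proj₁ eq)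
... | eqα , refl with replicate-++-injective b b′ (All.map s≤s boundβ) (All.map s≤s boundβ′) (cong proj₂ eq)
... | refl , refl = refl , refl , cong (_, _) (map-injective (λ {x} {y} → +-cancelʳ-≡ a x y) eqα)

durfeePairs-unique : ∀ i B → Unique (durfeePairs (suc i) B)
durfeePairs-unique zero B = Unique.map⁺ (λ eq → proj₁ (∷-injective (cong proj₁ eq))) (Unique.upTo⁺ (suc B))
durfeePairs-unique (suc i) B =
  unique-concatMap (levelBlock (suc i) B) (Unique.upTo⁺ _) (λ _ → levelBlock-unique) levels-disjoint
  where
  j = suc (suc i)
  narrow-bound : ∀ {B′ p} → p ∈ durfeePairs (suc i) B′ → All (_≤ suc i) (proj₂ p)
  narrow-bound p∈ = durfeePair-β-bound (suc i) _ (durfeePairs-sound i _ p∈)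
  levelBlock-unique : ∀ {m} → Unique (levelBlock (suc i) B m)
  levelBlock-unique {m} = unique-concatMap _ (Unique.upTo⁺ _)
    (λ {a} _ → unique-map (extendPair j a (m ∸ a)) (durfeePairs-unique i _)
                 (λ p∈ q∈ eq → proj₂ (proj₂ (extendPair-injective i (narrow-bound p∈) (narrow-bound q∈) eq))))
    splits-disjoint
    where
    splits-disjoint : ∀ {a a′ z} → a ∈ upTo (suc m) → a′ ∈ upTo (suc m) →
      z ∈ map (extendPair j a (m ∸ a)) (durfeePairs (suc i) (B ∸ j * m)) →
      z ∈ map (extendPair j a′ (m ∸ a′)) (durfeePairs (suc i) (B ∸ j * m)) → a ≡ a′
    splits-disjoint _ _ z∈ z∈′ with ∈-map⁻ _ z∈ | ∈-map⁻ _ z∈′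
    ... | p , p∈ , refl | q , q∈ , eq = proj₁ (extendPair-injective i (narrow-bound p∈) (narrow-bound q∈) eq)
  levels-disjoint : ∀ {m m′ z} → m ∈ upTo (suc (B / j)) → m′ ∈ upTo (suc (B / j)) →
    z ∈ levelBlock (suc i) B m → z ∈ levelBlock (suc i) B m′ → m ≡ m′
  levels-disjoint {m} {m′} _ _ z∈ z∈′ with ∈-levelBlock⁻ (suc i) B m z∈ | ∈-levelBlock⁻ (suc i) B m′ z∈′
  ... | a , p , a≤m , p∈ , refl | a′ , q , a′≤m′ , q∈ , eq
    with extendPair-injective i (narrow-bound p∈) (narrow-bound q∈) eq
  ... | refl , rest≡ , _ = trans (sym (m+[n∸m]≡n a≤m)) (trans (cong (a +_) rest≡) (m+[n∸m]≡n a′≤m′))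

part-∈ : ∀ xs j → 1 ≤ j → j ≤ length xs → part xs j ∈ xs
part-∈ (x ∷ xs) (suc zero) _ _ = here refl
part-∈ (x ∷ xs) (suc (suc j)) _ (s≤s j≤) = there (part-∈ xs (suc j) (s≤s z≤n) j≤)

part-all : {P : ℕ → Set} → ∀ xs j → All P xs → P 0 → P (part xs j)
part-all [] j _ p0 = p0
part-all (x ∷ xs) zero _ p0 = p0
part-all (x ∷ xs) (suc zero) (px ∷ _) _ = px
part-all (x ∷ xs) (suc (suc j)) (_ ∷ ps) p0 = part-all xs (suc j) ps p0

part-beyond : ∀ xs j → length xs < j → part xs j ≡ 0
part-beyond [] j _ = refl
part-beyond (x ∷ xs) (suc (suc j)) (s≤s j>) = part-beyond xs (suc j) j>

part-++ˡ : ∀ xs ys j → 1 ≤ j → j ≤ length xs → part (xs ++ ys) j ≡ part xs j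
part-++ˡ (x ∷ xs) ys (suc zero) _ _ = refl
part-++ˡ (x ∷ xs) ys (suc (suc j)) _ (s≤s j≤) = part-++ˡ xs ys (suc j) (s≤s z≤n) j≤

part-++ʳ : ∀ xs ys d → part (xs ++ ys) (length xs + suc d) ≡ part ys (suc d)
part-++ʳ [] ys d = refl
part-++ʳ (x ∷ xs) ys d =
  trans (cong (λ j → part (x ∷ xs ++ ys) (suc j)) (+-suc (length xs) d))
        (trans (cong (part (xs ++ ys)) (sym (+-suc (length xs) d))) (part-++ʳ xs ys d))

take-above : ∀ λs j → Decreasing λs → 1 ≤ j → j ≤ length λs → All (part λs j ≤_) (take j λs)
take-above (x ∷ xs) (suc zero) _ _ _ = ≤-refl ∷ []
take-above (x ∷ xs) (suc (suc j)) dec _ (s≤s j≤) =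
  All.lookup (decreasing-head x xs dec) (part-∈ xs (suc j) (s≤s z≤n) j≤) ∷
  take-above xs (suc j) (Linked.tail dec) (s≤s z≤n) j≤

drop-below : ∀ λs j → Decreasing λs → All (_≤ part λs (suc j)) (drop j λs)
drop-below [] zero _ = []
drop-below [] (suc j) _ = []
drop-below (x ∷ xs) zero dec = ≤-refl ∷ decreasing-head x xs dec
drop-below (x ∷ xs) (suc j) dec = drop-below xs j (Linked.tail dec)

glue : ℕ → List ℕ × List ℕ → List ℕ
glue k (α , β) = map (_+ k) α ++ β

durfeeList : ℕ → ℕ → List (List ℕ)
durfeeList n k = map (glue k) (durfeePairs k (n ∸ k * k))

glue-sum : ∀ k α β → length α ≡ k → sum (glue k (α , β)) ≡ (sum α + sum β) + k * k
glue-sum k α β len = begin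
  sum (map (_+ k) α ++ β)      ≡⟨ sum-++ (map (_+ k) α) β ⟩
  sum (map (_+ k) α) + sum β   ≡⟨ cong (_+ sum β) (sum-map-+ k α) ⟩
  sum α + length α * k + sum β ≡⟨ cong (λ l → sum α + l * k + sum β) len ⟩
  sum α + k * k + sum β        ≡⟨ swap (sum α) (k * k) (sum β) ⟩
  sum α + sum β + k * k        ∎
  where
  open ≡-Reasoning
  swap : ∀ x y z → x + y + z ≡ x + z + y
  swap = solve-∀

glue-sound : ∀ i B {p} → DurfeePair (suc i) B p →
  IsPartition (B + suc i * suc i) (glue (suc i) p) × DurfeeOrder (glue (suc i) p) (suc i)
glue-sound i B {α , β} (len , decα , boundsβ , decβ , size) =
  (positive , decreasing , total) , inj₂ square-fits , beyond-square
  where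
  k = suc i
  shifted-len : length (map (_+ k) α) ≡ k
  shifted-len = trans (length-map (_+ k) α) len
  above : All (k ≤_) (map (_+ k) α)
  above = All.map⁺ (All.tabulate (λ {y} _ → m≤n+m k y))
  positive : All (1 ≤_) (glue k (α , β))
  positive = All.++⁺ (All.map (≤-trans (s≤s z≤n)) above) (All.map proj₁ boundsβ)
  decreasing : Decreasing (glue k (α , β))
  decreasing = linked-++ (map (_+ k) α) (shift-decreasing k decα) decβ
    (All.map (λ k≤y → All.map (λ (_ , b≤k) → ≤-trans b≤k k≤y) boundsβ) above)
  total : sum (glue k (α , β)) ≡ B + k * k
  total = trans (glue-sum k α β len) (cong (_+ k * k) size)
  square-fits : k ≤ part (glue k (α , β)) k
  square-fits = subst (k ≤_) (sym (part-++ˡ (map (_+ k) α) β k (s≤s z≤n) (≤-reflexive (sym shifted-len))))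
                  (All.lookup above (part-∈ (map (_+ k) α) k (s≤s z≤n) (≤-reflexive (sym shifted-len))))
  beyond-square : ∀ j → k < j → part (glue k (α , β)) j < j
  beyond-square j k<j = ≤-trans (s≤s below-k) k<j
    where
    j-eq : length (map (_+ k) α) + suc (j ∸ suc k) ≡ j
    j-eq = trans (cong (_+ suc (j ∸ suc k)) shifted-len) (trans (+-suc k (j ∸ suc k)) (m+[n∸m]≡n k<j))
    below-k : part (glue k (α , β)) j ≤ k
    below-k = subst (λ c → part (glue k (α , β)) c ≤ k) j-eq
      (subst (_≤ k) (sym (part-++ʳ (map (_+ k) α) β (j ∸ suc k)))
        (part-all β (suc (j ∸ suc k)) (All.map proj₂ boundsβ) z≤n))

durfee-split : ∀ n i λs → IsPartition n λs → DurfeeOrder λs (suc i) →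
  suc i * suc i ≤ n × ∃ λ p → DurfeePair (suc i) (n ∸ suc i * suc i) p × glue (suc i) p ≡ λs
durfee-split n i λs (positive , decreasing , total) (inj₂ square-fits , beyond-square) =
  k²≤n , (α , ys) , (lenα , decα , boundsys , decys , size) , glued
  where
  k = suc i
  k≤length : k ≤ length λs
  k≤length with k ≤? length λs
  ... | yes k≤ = k≤
  ... | no k≰ = ⊥-elim (n≮0 (≤-trans square-fits (≤-reflexive (part-beyond λs k (≰⇒> k≰)))))
  xs = take k λs
  ys = drop k λs
  split-eq : xs ++ ys ≡ λs
  split-eq = take++drop≡id k λs
  decreasing′ : Decreasing (xs ++ ys)
  decreasing′ = subst Decreasing (sym split-eq) decreasing
  above : All (k ≤_) xs
  above = All.map (≤-trans square-fits) (take-above λs k decreasing (s≤s z≤n) k≤length)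
  boundsys : All (λ y → 1 ≤ y × y ≤ k) ys
  boundsys = All.zipWith (λ (1≤y , y≤) → 1≤y , ≤-pred (≤-trans (s≤s y≤) (beyond-square (suc k) ≤-refl)))
    (All.++⁻ʳ xs (subst (All (1 ≤_)) (sym split-eq) positive) , drop-below λs k decreasing)
  α = map (_∸ k) xs
  restored : map (_+ k) α ≡ xs
  restored = map-+-∸ k xs above
  lenα : length α ≡ k
  lenα = trans (length-map (_∸ k) xs) (trans (length-take k λs) (m≤n⇒m⊓n≡m k≤length))
  decα : Decreasing α
  decα = linked-map (_∸ k) (proj₁ (linked-++⁻ xs decreasing′)) above (λ _ _ r → ∸-monoˡ-≤ k r)
  decys : Decreasing ys
  decys = proj₂ (linked-++⁻ xs decreasing′)
  glued : glue k (α , ys) ≡ λs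
  glued = trans (cong (_++ ys) restored) split-eq
  size-eq : sum α + sum ys + k * k ≡ n
  size-eq = trans (sym (glue-sum k α ys lenα)) (trans (cong sum glued) total)
  k²≤n : k * k ≤ n
  k²≤n = subst (k * k ≤_) size-eq (m≤n+m (k * k) _)
  size : sum α + sum ys ≡ n ∸ k * k
  size = sym (trans (cong (_∸ k * k) (sym size-eq)) (m+n∸n≡m _ (k * k)))

glue-injective : ∀ k {p q} → length (proj₁ p) ≡ k → length (proj₁ q) ≡ k → glue k p ≡ glue k q → p ≡ q
glue-injective k {α , β} {α′ , β′} len len′ eq
  with ++-split (map (_+ k) α) (map (_+ k) α′) β β′
         (trans (length-map _ α) (trans len (sym (trans (length-map _ α′) len′)))) eq
... | eqα , refl = cong (_, β) (map-injective (λ {x} {y} → +-cancelʳ-≡ k x y) eqα)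

durfeeList-enumerates : ∀ n i → suc i * suc i ≤ n →
  Enumerates (durfeeList n (suc i)) (λ λs → IsPartition n λs × DurfeeOrder λs (suc i))
durfeeList-enumerates n i k²≤n = unique , λ λs → mk⇔ sound complete
  where
  k = suc i
  B = n ∸ k * k
  pair-length : ∀ {p} → p ∈ durfeePairs k B → length (proj₁ p) ≡ k
  pair-length p∈ = proj₁ (durfeePairs-sound i B p∈)
  unique : Unique (durfeeList n k)
  unique = unique-map (glue k) (durfeePairs-unique i B) (λ p∈ q∈ → glue-injective k (pair-length p∈) (pair-length q∈))
  sound : ∀ {λs} → λs ∈ durfeeList n k → IsPartition n λs × DurfeeOrder λs k
  sound λs∈ with ∈-map⁻ (glue k) λs∈
  ... | p , p∈ , refl with glue-sound i B (durfeePairs-sound i B p∈)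
  ... | (positive , decreasing , total) , order = (positive , decreasing , trans total (m∸n+n≡m k²≤n)) , order
  complete : ∀ {λs} → IsPartition n λs × DurfeeOrder λs k → λs ∈ durfeeList n k
  complete {λs} (partition , order) with durfee-split n i λs partition order
  ... | _ , p , spec , glued = subst (_∈ durfeeList n k) glued (∈-map⁺ (glue k) (durfeePairs-complete i B spec))

durfeeList-length : ∀ n i → suc i * suc i ≤ n → length (durfeeList n (suc i)) ≡ multisum n (suc i)
durfeeList-length n i k²≤n = begin
  length (durfeeList n k)                    ≡⟨ length-map (glue k) (durfeePairs k B) ⟩
  length (durfeePairs k B)                   ≡⟨ durfeePairs-length i B ⟩
  sum (map (termAt (suc B)) (tuples k B))    ≡⟨ cong (λ c → sum (map (termAt c) (tuples k B))) (sym (+-∸-assoc 1 k²≤n)) ⟩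
  sum (map (termAt (1 + n ∸ k * k)) (range n k)) ∎
  where
  open ≡-Reasoning
  k = suc i
  B = n ∸ k * k

positive-order-fits : ∀ λs {j} → j ≡ 0 ⊎ j ≤ part λs j → 1 ≤ j → j ≤ part λs j
positive-order-fits λs (inj₁ refl) ()
positive-order-fits λs (inj₂ j≤λj) _ = j≤λj

durfeeOrder-unique : ∀ λs {k k′} → DurfeeOrder λs k → DurfeeOrder λs k′ → k ≡ k′
durfeeOrder-unique λs {k} {k′} (fits , beyond) (fits′ , beyond′) with <-cmp k k′
... | tri≈ _ k≡k′ _ = k≡k′
... | tri< k<k′ _ _ = ⊥-elim (<⇒≱ (beyond k′ k<k′) (positive-order-fits λs fits′ (≤-trans (s≤s z≤n) k<k′)))
... | tri> _ _ k′<k = ⊥-elim (<⇒≱ (beyond′ k k′<k) (positive-order-fits λs fits (≤-trans (s≤s z≤n) k′<k)))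

-- ... and exists.  Below any bound N there is a largest candidate k with λ_k ≥ k (k = 0 always
-- qualifies); for N = length λs it is the Durfee order, as parts beyond the length are 0.
largest-fitting : ∀ λs N → ∃ λ k → (k ≡ 0 ⊎ k ≤ part λs k) × (∀ j → k < j → j ≤ N → part λs j < j)
largest-fitting λs zero = 0 , inj₁ refl , λ j 0<j j≤0 → ⊥-elim (<⇒≱ 0<j j≤0)
largest-fitting λs (suc N) with suc N ≤? part λs (suc N)
... | yes fits = suc N , inj₂ fits , λ j N<j j≤N → ⊥-elim (<⇒≱ N<j j≤N)
... | no ¬fits with largest-fitting λs N
... | k , fits , beyond = k , fits , beyond′
  where
  beyond′ : ∀ j → k < j → j ≤ suc N → part λs j < j
  beyond′ j k<j j≤1+N with m≤n⇒m<n∨m≡n j≤1+N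
  ... | inj₁ j<1+N = beyond j k<j (≤-pred j<1+N)
  ... | inj₂ refl  = ≰⇒> ¬fits

durfeeOrder-exists : ∀ λs → ∃ (DurfeeOrder λs)
durfeeOrder-exists λs with largest-fitting λs (length λs)
... | k , fits , beyond = k , fits , beyond′
  where
  beyond′ : ∀ j → k < j → part λs j < j
  beyond′ j k<j with j ≤? length λs
  ... | yes j≤len = beyond j k<j j≤len
  ... | no j≰len = subst (_< j) (sym (part-beyond λs j (≰⇒> j≰len))) (≤-trans (s≤s z≤n) k<j)

durfeeOrder-positive : ∀ x xs {k} → 1 ≤ x → DurfeeOrder (x ∷ xs) k → 1 ≤ k
durfeeOrder-positive x xs {zero} 1≤x (_ , beyond) = ⊥-elim (<⇒≱ (beyond 1 (s≤s z≤n)) 1≤x)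
durfeeOrder-positive x xs {suc k} _ _ = s≤s z≤n

GappedPartition : ℕ → ℕ → List ℕ → Set
GappedPartition j B μ = length μ ≡ j × All (1 ≤_) μ × Gapped μ × sum μ ≡ B + j * j

extendGapped : ℕ → List ℕ → List ℕ
extendGapped m μ = map (_+ (m + 2)) μ ∷ʳ suc m

gappedLists : ℕ → ℕ → List (List ℕ)
gappedLists zero B = [] ∷ []
gappedLists (suc zero) B = (suc B ∷ []) ∷ []
gappedLists (suc (suc i)) B =
  concatMap (λ m → map (extendGapped m) (gappedLists (suc i) (B ∸ suc (suc i) * m))) (upTo (suc (B / suc (suc i))))

gappedLists-length : ∀ j B → length (gappedLists j B) ≡ length (tuples j B)
gappedLists-length zero B = refl
gappedLists-length (suc zero) B = refl
gappedLists-length (suc (suc i)) B = begin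
  length (concatMap gapped ms)          ≡⟨ length-concatMap gapped ms ⟩
  sum (map (length ∘ gapped) ms)
    ≡⟨ sum-map-cong _ _ ms (λ {m} _ → same-length m (gappedLists-length (suc i) (B ∸ j * m))) ⟩
  sum (map (length ∘ tupled) ms)        ≡⟨ sym (length-concatMap tupled ms) ⟩
  length (concatMap tupled ms)          ∎
  where
  open ≡-Reasoning
  j = suc (suc i)
  ms = upTo (suc (B / j))
  gapped = λ m → map (extendGapped m) (gappedLists (suc i) (B ∸ j * m))
  tupled = λ m → map ((j , m) ∷_) (tuples (suc i) (B ∸ j * m))
  same-length : ∀ m → length (gappedLists (suc i) (B ∸ j * m)) ≡ length (tuples (suc i) (B ∸ j * m)) →
    length (gapped m) ≡ length (tupled m)
  same-length m narrower = trans (length-map (extendGapped m) (gappedLists (suc i) (B ∸ j * m)))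
    (trans narrower (sym (length-map ((j , m) ∷_) (tuples (suc i) (B ∸ j * m)))))

gapped-head : ∀ x xs → Gapped (x ∷ xs) → All (1 ≤_) (x ∷ xs) → suc (2 * length xs) ≤ x
gapped-head x [] _ (1≤x ∷ _) = 1≤x
gapped-head x (y ∷ ys) (gap ∷ gaps) (_ ∷ positive) =
  ≤-trans (≤-reflexive (step (length ys))) (≤-trans (+-monoˡ-≤ 2 (gapped-head y ys gaps positive)) gap)
  where
  step : ∀ l → suc (2 * suc l) ≡ suc (2 * l) + 2
  step = solve-∀

gapped-sum : ∀ xs → Gapped xs → All (1 ≤_) xs → length xs * length xs ≤ sum xs
gapped-sum [] _ _ = z≤n
gapped-sum (x ∷ xs) gaps (1≤x ∷ positive) =
  ≤-trans (≤-reflexive (odd-sum (length xs)))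
    (+-mono-≤ (gapped-head x xs gaps (1≤x ∷ positive)) (gapped-sum xs (Linked.tail gaps) positive))
  where
  odd-sum : ∀ l → suc l * suc l ≡ suc (2 * l) + l * l
  odd-sum = solve-∀

extendGapped-sum : ∀ i m E μ → length μ ≡ suc i → sum μ ≡ E + suc i * suc i →
  sum (extendGapped m μ) ≡ (E + suc (suc i) * m) + suc (suc i) * suc (suc i)
extendGapped-sum i m E μ len size = begin
  sum (map (_+ (m + 2)) μ ∷ʳ suc m)                 ≡⟨ sum-++ (map (_+ (m + 2)) μ) _ ⟩
  sum (map (_+ (m + 2)) μ) + (suc m + 0)            ≡⟨ cong (_+ (suc m + 0)) (sum-map-+ (m + 2) μ) ⟩
  sum μ + length μ * (m + 2) + (suc m + 0)          ≡⟨ cong₂ (λ s l → s + l * (m + 2) + (suc m + 0)) size len ⟩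
  E + suc i * suc i + suc i * (m + 2) + (suc m + 0) ≡⟨ regroup E i m ⟩
  E + suc (suc i) * m + suc (suc i) * suc (suc i)   ∎
  where
  open ≡-Reasoning
  regroup : ∀ E i m → E + suc i * suc i + suc i * (m + 2) + (suc m + 0) ≡ E + suc (suc i) * m + suc (suc i) * suc (suc i)
  regroup = solve-∀

extendGapped-sound : ∀ i B m {μ} → suc (suc i) * m ≤ B → GappedPartition (suc i) (B ∸ suc (suc i) * m) μ →
  GappedPartition (suc (suc i)) B (extendGapped m μ)
extendGapped-sound i B m {μ} jm≤B (len , positive , gaps , size) = len′ , positive′ , gaps′ , size′
  where
  j = suc (suc i)
  len′ : length (extendGapped m μ) ≡ j
  len′ = trans (length-++ (map (_+ (m + 2)) μ)) (trans (cong (_+ 1) (trans (length-map _ μ) len)) (+-comm (suc i) 1))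
  positive′ : All (1 ≤_) (extendGapped m μ)
  positive′ = All.++⁺ (All.map⁺ (All.map (λ 1≤y → ≤-trans 1≤y (m≤m+n _ _)) positive)) (s≤s z≤n ∷ [])
  shift-gap : ∀ {a b} → b + 2 ≤ a → b + (m + 2) + 2 ≤ a + (m + 2)
  shift-gap {a} {b} gap = ≤-trans (≤-reflexive (+-right-swap b (m + 2) 2)) (+-monoˡ-≤ (m + 2) gap)
    where
    +-right-swap : ∀ x y z → x + y + z ≡ x + z + y
    +-right-swap = solve-∀
  gaps′ : Gapped (extendGapped m μ)
  gaps′ = linked-++ (map (_+ (m + 2)) μ) (Linked.map⁺ (Linked.map shift-gap gaps)) [-]
            (All.map⁺ (All.map (λ 1≤y → +-monoˡ-≤ (m + 2) 1≤y ∷ []) positive))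
  size′ : sum (extendGapped m μ) ≡ B + j * j
  size′ = trans (extendGapped-sum i m (B ∸ j * m) μ len size) (cong (_+ j * j) (m∸n+n≡m jm≤B))

-- Every gapped partition into j ≥ 2 parts is an extension of one into j − 1 parts: its smallest
-- part is m + 1, and the other parts exceed it by at least 2.
gapped-split : ∀ i B μ → GappedPartition (suc (suc i)) B μ →
  ∃₂ λ m μ′ → ∃ λ E → GappedPartition (suc i) E μ′ × E + suc (suc i) * m ≡ B × extendGapped m μ′ ≡ μ
gapped-split i B μ (len , positive , gaps , size) with split-last μ (suc i) len
... | μ₀ , zero , refl , _ = ⊥-elim (1+n≰n (All.lookup (All.++⁻ʳ μ₀ positive) (here refl)))
... | μ₀ , suc m , refl , len₀ = m , μ′ , E , (len′ , positive′ , gaps′ , size′) , budget , restored-last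
  where
  j = suc (suc i)
  c = m + 2
  above : All (λ a → suc m + 2 ≤ a) μ₀
  above = linked-last (λ q r → ≤-trans r (≤-trans (m≤m+n _ 2) q)) μ₀ gaps
  c≤ : All (c ≤_) μ₀
  c≤ = All.map (≤-trans (n≤1+n c)) above
  μ′ = map (_∸ c) μ₀
  restored : map (_+ c) μ′ ≡ μ₀
  restored = map-+-∸ c μ₀ c≤
  restored-last : extendGapped m μ′ ≡ μ₀ ∷ʳ suc m
  restored-last = cong (_∷ʳ suc m) restored
  len′ : length μ′ ≡ suc i
  len′ = trans (length-map (_∸ c) μ₀) len₀
  positive′ : All (1 ≤_) μ′
  positive′ = All.map⁺ (All.map (λ {a} c<a → subst (_≤ a ∸ c) (m+n∸n≡m 1 c) (∸-monoˡ-≤ c c<a)) above)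
  gaps′ : Gapped μ′
  gaps′ = linked-map (_∸ c) (proj₁ (linked-++⁻ μ₀ gaps)) c≤
            (λ {a} _ c≤b gap → subst (_≤ a ∸ c) (+-∸-comm 2 c≤b) (∸-monoˡ-≤ c gap))
  E = sum μ′ ∸ suc i * suc i
  size′ : sum μ′ ≡ E + suc i * suc i
  size′ = sym (m∸n+n≡m (subst (λ l → l * l ≤ sum μ′) len′ (gapped-sum μ′ gaps′ positive′)))
  budget : E + j * m ≡ B
  budget = +-cancelʳ-≡ (j * j) _ _ (trans (sym (extendGapped-sum i m E μ′ len′ size′))
                                         (trans (cong sum restored-last) size))

gappedLists-sound : ∀ i B {μ} → μ ∈ gappedLists (suc i) B → GappedPartition (suc i) B μ
gappedLists-sound zero B (here refl) = refl , s≤s z≤n ∷ [] , [-] , one-part B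
  where
  one-part : ∀ B → suc B + 0 ≡ B + 1 * 1
  one-part = solve-∀
gappedLists-sound (suc i) B μ∈ with ∈-concatMap-elim _ μ∈
... | m , m∈ , μ∈′ with ∈-map⁻ (extendGapped m) μ∈′
... | μ′ , μ′∈ , refl = extendGapped-sound i B m (∈-upTo-quotient⁻ (suc (suc i)) m B m∈) (gappedLists-sound i _ μ′∈)

gappedLists-complete : ∀ i B {μ} → GappedPartition (suc i) B μ → μ ∈ gappedLists (suc i) B
gappedLists-complete zero B {μ} (len , _ , _ , size) with split-last μ 0 len
... | [] , x , refl , _ = here (cong (_∷ []) (+-cancelʳ-≡ 0 x (suc B) (trans size (one-part B))))
  where
  one-part : ∀ B → B + 1 * 1 ≡ suc B + 0
  one-part = solve-∀
gappedLists-complete (suc i) B {μ} spec with gapped-split i B μ spec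
... | m , μ′ , E , narrower , budget , refl =
  ∈-concatMap-intro _ (∈-upTo-quotient⁺ j m B jm≤B)
    (∈-map⁺ (extendGapped m) (subst (λ b → μ′ ∈ gappedLists (suc i) b) E-eq (gappedLists-complete i E narrower)))
  where
  j = suc (suc i)
  jm≤B : j * m ≤ B
  jm≤B = subst (j * m ≤_) budget (m≤n+m (j * m) E)
  E-eq : E ≡ B ∸ j * m
  E-eq = sym (trans (cong (_∸ j * m) (sym budget)) (m+n∸n≡m E (j * m)))

extendGapped-injective : ∀ {m m′ μ μ′} → extendGapped m μ ≡ extendGapped m′ μ′ → m ≡ m′ × μ ≡ μ′
extendGapped-injective {m} {m′} {μ} {μ′} eq with ∷ʳ-injective (map (_+ (m + 2)) μ) (map (_+ (m′ + 2)) μ′) eq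
... | eqμ , refl = refl , map-injective (λ {x} {y} → +-cancelʳ-≡ (m + 2) x y) eqμ

gappedLists-unique : ∀ j B → Unique (gappedLists j B)
gappedLists-unique zero B = [] ∷ []
gappedLists-unique (suc zero) B = [] ∷ []
gappedLists-unique (suc (suc i)) B =
  unique-concatMap _ (Unique.upTo⁺ _)
    (λ {m} _ → Unique.map⁺ (proj₂ ∘ extendGapped-injective {m}) (gappedLists-unique (suc i) _))
    levels-disjoint
  where
  j = suc (suc i)
  levels-disjoint : ∀ {m m′ μ} → m ∈ upTo (suc (B / j)) → m′ ∈ upTo (suc (B / j)) →
    μ ∈ map (extendGapped m) (gappedLists (suc i) (B ∸ j * m)) →
    μ ∈ map (extendGapped m′) (gappedLists (suc i) (B ∸ j * m′)) → m ≡ m′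
  levels-disjoint _ _ μ∈ μ∈′ with ∈-map⁻ _ μ∈ | ∈-map⁻ _ μ∈′
  ... | _ , _ , refl | _ , _ , eq = proj₁ (extendGapped-injective eq)

gappedLists-enumerates : ∀ n i → suc i * suc i ≤ n →
  Enumerates (gappedLists (suc i) (n ∸ suc i * suc i)) (λ μ → IsR1Partition n μ × length μ ≡ suc i)
gappedLists-enumerates n i k²≤n = gappedLists-unique (suc i) _ , λ μ → mk⇔ sound complete
  where
  k = suc i
  sound : ∀ {μ} → μ ∈ gappedLists k (n ∸ k * k) → IsR1Partition n μ × length μ ≡ k
  sound μ∈ with gappedLists-sound i _ μ∈
  ... | len , positive , gaps , size = (positive , gaps , trans size (m∸n+n≡m k²≤n)) , len
  complete : ∀ {μ} → IsR1Partition n μ × length μ ≡ k → μ ∈ gappedLists k (n ∸ k * k)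
  complete ((positive , gaps , size) , len) =
    gappedLists-complete i _ (len , positive , gaps , trans size (sym (m∸n+n≡m k²≤n)))

∈-oneTo⁺ : ∀ s k → 1 ≤ k → k ≤ s → k ∈ oneTo s
∈-oneTo⁺ s (suc k) _ k<s = ∈-map⁺ suc (∈-upTo⁺ k<s)

∈-oneTo⁻ : ∀ s k → k ∈ oneTo s → ∃ λ i → k ≡ suc i × suc i ≤ s
∈-oneTo⁻ s k k∈ with ∈-map⁻ suc k∈
... | i , i∈ , refl = i , refl , ∈-upTo⁻ i∈

oneTo-unique : ∀ s → Unique (oneTo s)
oneTo-unique s = Unique.map⁺ suc-injective (Unique.upTo⁺ s)

nonempty : ∀ {n} λs → 1 ≤ n → sum λs ≡ n → ∃₂ λ x xs → λs ≡ x ∷ xs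
nonempty [] 1≤n refl = ⊥-elim (n≮0 1≤n)
nonempty (x ∷ xs) _ _ = x , xs , refl

partitionList : ℕ → List (List ℕ)
partitionList n = concatMap (durfeeList n) (oneTo (floorSqrt n))

partitionList-enumerates : ∀ n → 1 ≤ n → Enumerates (partitionList n) (IsPartition n)
partitionList-enumerates n 1≤n =
  enumerates-union (durfeeList n) (λ λs k → DurfeeOrder λs k) (oneTo-unique _) block
    (λ {λs} _ → durfeeOrder-unique λs) classify
  where
  block : ∀ {k} → k ∈ oneTo (floorSqrt n) →
    Enumerates (durfeeList n k) (λ λs → IsPartition n λs × DurfeeOrder λs k)
  block {k} k∈ with ∈-oneTo⁻ _ k k∈
  ... | i , refl , k≤s = durfeeList-enumerates n i (floorSqrt-sound n (suc i) k≤s)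
  classify : ∀ {λs} → IsPartition n λs → ∃ λ k → k ∈ oneTo (floorSqrt n) × DurfeeOrder λs k
  classify {λs} partition@(positive , _ , total) with durfeeOrder-exists λs | nonempty λs 1≤n total
  ... | k , order | x , xs , refl with durfeeOrder-positive x xs (All.head positive) order
  ... | 1≤k@(s≤s _) =
    k , ∈-oneTo⁺ _ k 1≤k (floorSqrt-complete n k (proj₁ (durfee-split n _ (x ∷ xs) partition order))) , order

partitionList-length : ∀ n → length (partitionList n) ≡ sum (map (multisum n) (oneTo (floorSqrt n)))
partitionList-length n = trans (length-concatMap (durfeeList n) (oneTo (floorSqrt n)))
                               (sum-map-cong _ _ (oneTo (floorSqrt n)) block-length)
  where
  block-length : ∀ {k} → k ∈ oneTo (floorSqrt n) → length (durfeeList n k) ≡ multisum n k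
  block-length {k} k∈ with ∈-oneTo⁻ _ k k∈
  ... | i , refl , k≤s = durfeeList-length n i (floorSqrt-sound n (suc i) k≤s)

gappedList : ℕ → List (List ℕ)
gappedList n = concatMap (λ k → gappedLists k (n ∸ k * k)) (oneTo (floorSqrt n))

gappedList-enumerates : ∀ n → 1 ≤ n → Enumerates (gappedList n) (IsR1Partition n)
gappedList-enumerates n 1≤n =
  enumerates-union (λ k → gappedLists k (n ∸ k * k)) (λ μ k → length μ ≡ k) (oneTo-unique _) block
    (λ _ p q → trans (sym p) q) classify
  where
  block : ∀ {k} → k ∈ oneTo (floorSqrt n) →
    Enumerates (gappedLists k (n ∸ k * k)) (λ μ → IsR1Partition n μ × length μ ≡ k)
  block {k} k∈ with ∈-oneTo⁻ _ k k∈
  ... | i , refl , k≤s = gappedLists-enumerates n i (floorSqrt-sound n (suc i) k≤s)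
  classify : ∀ {μ} → IsR1Partition n μ → ∃ λ k → k ∈ oneTo (floorSqrt n) × length μ ≡ k
  classify {μ} (positive , gaps , total) with nonempty μ 1≤n total
  ... | x , xs , refl = length μ , ∈-oneTo⁺ _ (length μ) (s≤s z≤n) (floorSqrt-complete n _ k²≤n) , refl
    where
    k²≤n : length μ * length μ ≤ n
    k²≤n = subst (length μ * length μ ≤_) total (gapped-sum μ gaps positive)

gappedList-length : ∀ n → length (gappedList n) ≡ totalTerms n
gappedList-length n = begin
  length (gappedList n)
    ≡⟨ length-concatMap (λ k → gappedLists k (n ∸ k * k)) (oneTo (floorSqrt n)) ⟩
  sum (map (λ k → length (gappedLists k (n ∸ k * k))) (oneTo (floorSqrt n)))
    ≡⟨ sum-map-cong _ _ (oneTo (floorSqrt n)) (λ {k} _ → gappedLists-length k (n ∸ k * k)) ⟩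
  totalTerms n ∎
  where open ≡-Reasoning

mainTheorem6 : (n : ℕ) → 1 ≤ n →
    ((P : List (List ℕ)) → Unique P → (∀ λs → λs ∈ P ⇔ IsPartition n λs) →
      length P ≡ sum (map (multisum n) (oneTo (floorSqrt n))))
    × ((k : ℕ) → 1 ≤ k → k ≤ floorSqrt n →
      (Dk : List (List ℕ)) → Unique Dk →
      (∀ λs → λs ∈ Dk ⇔ (IsPartition n λs × DurfeeOrder λs k)) →
      length Dk ≡ multisum n k)
    × ((R : List (List ℕ)) → Unique R → (∀ λs → λs ∈ R ⇔ IsR1Partition n λs) →
      totalTerms n ≡ length R)
mainTheorem6 n 1≤n = partition-count , durfee-count , term-count
  where
  partition-count : (P : List (List ℕ)) → Unique P → (∀ λs → λs ∈ P ⇔ IsPartition n λs) →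
    length P ≡ sum (map (multisum n) (oneTo (floorSqrt n)))
  partition-count P uP exP =
    trans (enumeration-length (uP , exP) (partitionList-enumerates n 1≤n)) (partitionList-length n)
  durfee-count : (k : ℕ) → 1 ≤ k → k ≤ floorSqrt n → (Dk : List (List ℕ)) → Unique Dk →
    (∀ λs → λs ∈ Dk ⇔ (IsPartition n λs × DurfeeOrder λs k)) → length Dk ≡ multisum n k
  durfee-count (suc i) _ k≤s Dk uD exD =
    trans (enumeration-length (uD , exD) (durfeeList-enumerates n i k²≤n)) (durfeeList-length n i k²≤n)
    where
    k²≤n : suc i * suc i ≤ n
    k²≤n = floorSqrt-sound n (suc i) k≤s
  term-count : (R : List (List ℕ)) → Unique R → (∀ λs → λs ∈ R ⇔ IsR1Partition n λs) → totalTerms n ≡ length R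
  term-count R uR exR =
    trans (sym (gappedList-length n)) (enumeration-length (gappedList-enumerates n 1≤n) (uR , exR))
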